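{- For an integer $n\ge 2$ let $\mathtt{A}=[a_{ij}]$ be the $n\times n$ matrix with $a_{ij}=1$ if $j=i+1$ or $i+j=n+1$, and $a_{ij}=0$ otherwise. For $k\ge 1$ let $f(k)$ be the number of sequences $(i_1,\dots,i_k)\in\{1,\dots,n\}^k$ with $a_{i_t i_{t+1}}=1$ for all $t=1,\dots,k-1$ (equivalently, $f(k)=v_n\mathtt{A}^{k-1}v_n^T$ with $v_n=[1\ \cdots\ 1]_{1\times n}$). Let $\alpha_0,\dots,\alpha_n$ be the coefficients of the polynomial $P_n(\lambda)=\alpha_0\lambda^n+\alpha_1\lambda^{n-1}+\dots+\alpha_n$ given by $$P_n(\lambda)=\begin{cases}\displaystyle\sum_{k=1}^{[\frac{n+2}{4}]+1}(-1)^{k-1}\binom{\frac n2-k+2}{k-1}\lambda^{n-2k+2}, & n \text{ even},\\[3ex] \displaystyle\sum_{k=1}^{[\frac{n+2}{4}]+2}(-1)^{k-1}\left(\binom{\frac{n+3}{2}-k}{k-1}+\binom{\frac{n+3}{2}-k}{k-2}\lambda\right)\lambda^{n-2k+2}, & n \text{ odd}\end{cases}$$ (this is, up to the sign $(-1)^n$, the characteristic polynomial $|\mathtt{A}-\lambda\mathtt{I}|$). Then for all $k>n$, $$\alpha_0f(k)+\alpha_1f(k-1)+\dots+\alpha_nf(k-n)=0.$$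
   Context: $f(k)$ counts the meaningful compositions $\nabla_{i_k}\circ\cdots\circ\nabla_{i_1}$ of order $k$ of the maps $\nabla_1:A_0\to A_1,\ \nabla_2:A_1\to A_2,\dots$ up to $A_{[n/2]}$ and back down to $\nabla_n:A_1\to A_0$ (with $\nabla_{m+1}:A_m\to A_m$ when $n=2m+1$), the sets $A_i$ being nonempty; $a_{ij}=1$ exactly when $\nabla_j\circ\nabla_i$ is meaningful. $[x]$ is the integer part; $\binom{a}{b}=0$ if $b<0$ or $b>a$. -}

module Defs where

open import Data.Nat using (ℕ; zero; suc; _+_; _*_; _∸_; _/_; _≟_)
open import Data.Nat.Combinatorics using (_C_)
open import Data.Fin using (Fin; toℕ)
open import Data.Bool using (if_then_else_)
open import Data.List using (List; map; upTo)
open import Relation.Nullary using (does)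
open import Data.Integer as ℤ using (ℤ; +_; -[1+_]; _-_)

-- Sum over Fin n (0-indexed: Fin n ↔ {1,…,n} via toℕ i + 1).
ΣFin : ∀ {n} → (Fin n → ℕ) → ℕ
ΣFin {zero}  g = 0
ΣFin {suc n} g = g Fin.zero + ΣFin (λ i → g (Fin.suc i))
  where import Data.Fin as Fin

ΣFinℤ : ∀ {n} → (Fin n → ℤ) → ℤ
ΣFinℤ {zero}  g = + 0
ΣFinℤ {suc n} g = g Fin.zero ℤ.+ ΣFinℤ (λ i → g (Fin.suc i))
  where import Data.Fin as Fin

sumℤ : List ℤ → ℤ
sumℤ Data.List.[] = + 0
sumℤ (x Data.List.∷ xs) = x ℤ.+ sumℤ xs

a : (n : ℕ) → Fin n → Fin n → ℕ
a n i j =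
  if does (toℕ j ≟ toℕ i + 1) then 1
  else if does ((toℕ i + 1) + (toℕ j + 1) ≟ n + 1) then 1
  else 0

-- w n k i = (A^(k-1) v^T)_i for k ≥ 1 ; w n 0 i = 1 (unused for k = 0).
w : (n : ℕ) → ℕ → Fin n → ℕ
w n zero    i = 1
w n (suc zero) i = 1
w n (suc (suc k)) i = ΣFin (λ j → a n i j * w n (suc k) j)

f : (n : ℕ) → ℕ → ℕ
f n k = ΣFin (λ i → w n k i)

-- Binomial coefficient with integer lower index: 0 if b < 0 (and _C_ gives 0 if b > a).
binom : ℕ → ℤ → ℕ
binom x (+ b)    = x C b
binom x -[1+ _ ] = 0

sgn : ℕ → ℤ
sgn zero = + 1
sgn (suc e) = ℤ.- sgn e

when : ℕ → ℕ → ℤ → ℤ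
when x y c = if does (x ≟ y) then c else + 0

-- The term λ^{n-2k+2} is matched by e + 2k = n + 2,
-- the term λ^{n-2k+3} by e + 2k = n + 3 (negative exponents never match,
-- and only occur with zero coefficients).
coeffP : (n e : ℕ) → ℤ
coeffP n e with does (n Data.Nat.% 2 ≟ 0)
... | Data.Bool.true =
  sumℤ (map (λ k → sgn (k ∸ 1) ℤ.*
              when (e + 2 * k) (n + 2) (+ ((n / 2 + 2 ∸ k) C (k ∸ 1))))
            (map suc (upTo ((n + 2) / 4 + 1))))
  where import Data.Nat
... | Data.Bool.false =
  sumℤ (map (λ k → sgn (k ∸ 1) ℤ.*
              (when (e + 2 * k) (n + 2) (+ binom ((n + 3) / 2 ∸ k) (+ k - + 1))
               ℤ.+ when (e + 2 * k) (n + 3) (+ binom ((n + 3) / 2 ∸ k) (+ k - + 2))))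
            (map suc (upTo ((n + 2) / 4 + 2))))
  where import Data.Nat

α : (n j : ℕ) → ℤ
α n j = coeffP n (n ∸ j)

module Submission where

-- Walk counts are constant on the classes {i, n − i} of 1-based vertices, and these classes form
-- the path 0 — 1 — ⋯ — D, with D = ⌊n/2⌋, carrying r = n mod 2 loops at D.  On that path the count
-- w_c(t) from vertex c equals P_c(E) w₀, where E is the shift and P_c the characteristic
-- polynomial of the path on c vertices, so the end vertex forces (P_{D+1} − r P_D)(E) w₀ = 0.
-- Annihilation is linear and shift invariant, hence passes to every w_c and to f = Σ w_c.
-- Finally P_n(λ) = λ^(n−D−1) (P_{D+1} − r P_D) since (−1)^i C(p−i, i) are the coefficients of P_p.

open import Defs
open import Data.Nat as ℕ using (ℕ; zero; suc; pred; _∸_; _⊓_; _≤_; _<_; z≤n; s≤s)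
import Data.Nat.Properties as ℕ
open import Data.Integer using (ℤ; +_; -_; _+_; _-_; _*_)
import Data.Integer.Properties as ℤ
open import Data.Integer.Tactic.RingSolver using (solve-∀)
import Data.Nat.Tactic.RingSolver as ℕ
open import Algebra.Properties.CommutativeSemigroup ℤ.+-commutativeSemigroup using (interchange)
open import Data.Nat.Combinatorics using (_C_; k>n⇒nCk≡0; nCk+nC[k+1]≡[n+1]C[k+1])
open import Data.Fin using (Fin; toℕ)
import Data.Fin as Fin
import Data.Fin.Properties as FinP
open import Data.Nat.DivMod using (_/_; _%_; m*n/n≡m; /-monoˡ-≤; [m+kn]%n≡m%n)
open import Data.Product using (_×_; _,_; proj₂; ∃)
open import Data.Sum using (_⊎_; inj₁; inj₂)
open import Data.List using (map; applyUpTo)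
open import Data.Bool using (true; false; if_then_else_)
open import Function using (_∘_; flip)
open import Relation.Nullary using (Dec; yes; no; does)
open import Relation.Nullary.Decidable using (dec-true; dec-false)
open import Data.Empty using (⊥-elim)
open import Relation.Binary.PropositionalEquality

Σℤ : ℕ → (ℕ → ℤ) → ℤ
Σℤ zero    F = + 0
Σℤ (suc N) F = F 0 + Σℤ N (F ∘ suc)

ΣFinℤ≡Σℤ : ∀ N (F : ℕ → ℤ) → ΣFinℤ {N} (F ∘ toℕ) ≡ Σℤ N F
ΣFinℤ≡Σℤ zero    F = refl
ΣFinℤ≡Σℤ (suc N) F = cong (_+_ (F 0)) (ΣFinℤ≡Σℤ N (F ∘ suc))

Σℤ-cong : ∀ N {F G : ℕ → ℤ} → (∀ j → j < N → F j ≡ G j) → Σℤ N F ≡ Σℤ N G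
Σℤ-cong zero    F≡G = refl
Σℤ-cong (suc N) F≡G = cong₂ _+_ (F≡G 0 (s≤s z≤n)) (Σℤ-cong N (λ j j<N → F≡G (suc j) (s≤s j<N)))

Σℤ-zero : ∀ N {F : ℕ → ℤ} → (∀ j → F j ≡ + 0) → Σℤ N F ≡ + 0
Σℤ-zero zero    F≡0 = refl
Σℤ-zero (suc N) F≡0 = cong₂ _+_ (F≡0 0) (Σℤ-zero N (F≡0 ∘ suc))

Σℤ-+ : ∀ N (F G : ℕ → ℤ) → Σℤ N (λ j → F j + G j) ≡ Σℤ N F + Σℤ N G
Σℤ-+ zero    F G = refl
Σℤ-+ (suc N) F G = begin
  (F 0 + G 0) + Σℤ N (λ j → F (suc j) + G (suc j))  ≡⟨ cong (_+_ (F 0 + G 0)) (Σℤ-+ N (F ∘ suc) (G ∘ suc)) ⟩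
  (F 0 + G 0) + (Σℤ N (F ∘ suc) + Σℤ N (G ∘ suc))    ≡⟨ interchange (F 0) (G 0) (Σℤ N (F ∘ suc)) (Σℤ N (G ∘ suc)) ⟩
  (F 0 + Σℤ N (F ∘ suc)) + (G 0 + Σℤ N (G ∘ suc))    ∎
  where open ≡-Reasoning

Σℤ-* : ∀ N c (F : ℕ → ℤ) → Σℤ N (λ j → c * F j) ≡ c * Σℤ N F
Σℤ-* zero    c F = sym (ℤ.*-zeroʳ c)
Σℤ-* (suc N) c F = trans (cong (_+_ (c * F 0)) (Σℤ-* N c (F ∘ suc))) (sym (ℤ.*-distribˡ-+ c (F 0) _))

Σℤ-neg : ∀ N (F : ℕ → ℤ) → Σℤ N (λ j → - F j) ≡ - Σℤ N F
Σℤ-neg zero    F = refl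
Σℤ-neg (suc N) F = trans (cong (_+_ (- F 0)) (Σℤ-neg N (F ∘ suc))) (sym (ℤ.neg-distrib-+ (F 0) _))

Σℤ-− : ∀ N (F G : ℕ → ℤ) → Σℤ N (λ j → F j - G j) ≡ Σℤ N F - Σℤ N G
Σℤ-− N F G = trans (Σℤ-+ N F (λ j → - G j)) (cong (_+_ (Σℤ N F)) (Σℤ-neg N G))

Σℤ-single : ∀ N {F : ℕ → ℤ} c → (∀ i → i ≢ c → F i ≡ + 0) → (N ≤ c → F c ≡ + 0) → Σℤ N F ≡ F c
Σℤ-single zero          c       off far = sym (far z≤n)
Σℤ-single (suc N) {F} zero    off far =
  trans (cong (_+_ (F 0)) (Σℤ-zero N (λ i → off (suc i) λ ()))) (ℤ.+-identityʳ (F 0))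
Σℤ-single (suc N) {F} (suc c) off far =
  trans (cong (_+ Σℤ N (F ∘ suc)) (off 0 λ ()))
        (trans (ℤ.+-identityˡ _) (Σℤ-single N c (λ i i≢c → off (suc i) (i≢c ∘ ℕ.suc-injective)) (far ∘ s≤s)))

Σℤ-truncate : ∀ {M} N {F : ℕ → ℤ} → M ≤ N → (∀ j → M ≤ j → F j ≡ + 0) → Σℤ N F ≡ Σℤ M F
Σℤ-truncate N           z≤n       F≡0 = Σℤ-zero N (λ j → F≡0 j z≤n)
Σℤ-truncate (suc N) {F} (s≤s M≤N) F≡0 =
  cong (_+_ (F 0)) (Σℤ-truncate N M≤N (λ j M≤j → F≡0 (suc j) (s≤s M≤j)))

-- c j is the coefficient of λ^(N ∸ j).  Annihilates only involves s t with t > 0, which matters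
-- because f n 0 = n is a junk value.
convolve : (ℕ → ℤ) → ℕ → (ℕ → ℤ) → ℕ → ℤ
convolve c N s k = Σℤ (suc N) (λ j → c j * s (k ∸ j))

record Annihilates (c : ℕ → ℤ) (N : ℕ) (s : ℕ → ℤ) : Set where
  constructor annihilates
  field convolve≡0 : ∀ k → N < k → convolve c N s k ≡ + 0

module _ {c : ℕ → ℤ} {N : ℕ} where

  convolve-+ : ∀ s s' k → convolve c N (λ t → s t + s' t) k ≡ convolve c N s k + convolve c N s' k
  convolve-+ s s' k = trans (Σℤ-cong (suc N) (λ j _ → ℤ.*-distribˡ-+ (c j) (s (k ∸ j)) (s' (k ∸ j))))
                            (Σℤ-+ (suc N) (λ j → c j * s (k ∸ j)) (λ j → c j * s' (k ∸ j)))

  convolve-− : ∀ s s' k → convolve c N (λ t → s t - s' t) k ≡ convolve c N s k - convolve c N s' k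
  convolve-− s s' k = trans (convolve-+ s (λ t → - s' t) k)
    (cong (_+_ (convolve c N s k))
          (trans (Σℤ-cong (suc N) (λ j _ → sym (ℤ.neg-distribʳ-* (c j) (s' (k ∸ j)))))
                 (Σℤ-neg (suc N) (λ j → c j * s' (k ∸ j)))))

  annihilates-cong : ∀ {s s'} → (∀ t → 0 < t → s t ≡ s' t) → Annihilates c N s → Annihilates c N s'
  annihilates-cong s≡s' (annihilates ann) = annihilates λ k N<k → trans (Σℤ-cong (suc N) λ j j≤N →
      cong (c j *_) (sym (s≡s' (k ∸ j) (ℕ.m<n⇒0<n∸m (ℕ.≤-<-trans (ℕ.≤-pred j≤N) N<k)))))
    (ann k N<k)

  annihilates-shift : ∀ {s} → Annihilates c N s → Annihilates c N (s ∘ suc)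
  annihilates-shift {s} (annihilates ann) = annihilates λ k N<k → trans (Σℤ-cong (suc N) λ j j≤N →
      cong (λ i → c j * s i) (sym (ℕ.+-∸-assoc 1 (ℕ.≤-trans (ℕ.≤-pred j≤N) (ℕ.<⇒≤ N<k)))))
    (ann (suc k) (ℕ.m≤n⇒m≤1+n N<k))

  annihilates-+ : ∀ {s s'} → Annihilates c N s → Annihilates c N s' → Annihilates c N (λ t → s t + s' t)
  annihilates-+ {s} {s'} (annihilates ann) (annihilates ann') = annihilates λ k N<k →
    trans (convolve-+ s s' k) (cong₂ _+_ (ann k N<k) (ann' k N<k))

  annihilates-− : ∀ {s s'} → Annihilates c N s → Annihilates c N s' → Annihilates c N (λ t → s t - s' t)
  annihilates-− {s} {s'} (annihilates ann) (annihilates ann') = annihilates λ k N<k →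
    trans (convolve-− s s' k) (cong₂ _-_ (ann k N<k) (ann' k N<k))

  annihilates-0 : Annihilates c N (λ _ → + 0)
  annihilates-0 = annihilates λ k _ → Σℤ-zero (suc N) (λ j → ℤ.*-zeroʳ (c j))

  annihilates-ΣFin : ∀ M (g : ℕ → Fin M → ℕ) → (∀ i → Annihilates c N (λ t → + g t i)) →
                     Annihilates c N (λ t → + ΣFin (g t))
  annihilates-ΣFin zero    g ann = annihilates-0
  annihilates-ΣFin (suc M) g ann =
    annihilates-+ (ann Fin.zero) (annihilates-ΣFin M (λ t i → g t (Fin.suc i)) (ann ∘ Fin.suc))

convolve-truncate : ∀ {c N M} s k → N ≤ M → (∀ j → N < j → c j ≡ + 0) → convolve c M s k ≡ convolve c N s k
convolve-truncate {c} {N} {M} s k N≤M c≡0 =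
  Σℤ-truncate (suc M) {λ j → c j * s (k ∸ j)} (s≤s N≤M)
              (λ j N<j → trans (cong (_* s (k ∸ j)) (c≡0 j N<j)) (ℤ.*-zeroˡ (s (k ∸ j))))

annihilates-coeff-cong : ∀ {c d N s} → (∀ j → j ≤ N → c j ≡ d j) → Annihilates c N s → Annihilates d N s
annihilates-coeff-cong {c} {d} {N} {s} c≡d (annihilates ann) = annihilates λ k N<k →
  trans (Σℤ-cong (suc N) {G = λ j → c j * s (k ∸ j)}
                 (λ j j≤N → cong (_* s (k ∸ j)) (sym (c≡d j (ℕ.≤-pred j≤N)))))
        (ann k N<k)

annihilates-raise : ∀ {c N M s} → N ≤ M → (∀ j → N < j → c j ≡ + 0) → Annihilates c N s → Annihilates c M s
annihilates-raise {s = s} N≤M c≡0 (annihilates ann) = annihilates λ k M<k →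
  trans (convolve-truncate s k N≤M c≡0) (ann k (ℕ.≤-<-trans N≤M M<k))

annihilates-from : ∀ {c N s} → (∀ t → convolve c N s (N ℕ.+ suc t) ≡ + 0) → Annihilates c N s
annihilates-from {c} {N} {s} ann = annihilates λ k N<k →
  subst (λ i → convolve c N s i ≡ + 0) (trans (ℕ.+-suc N (k ∸ suc N)) (ℕ.m+[n∸m]≡n N<k)) (ann (k ∸ suc N))

shift : (ℕ → ℤ) → ℕ → ℤ
shift c zero    = + 0
shift c (suc j) = c j

convolve-shift : ∀ c N s k → convolve (shift c) (suc N) s (suc k) ≡ convolve c N s k
convolve-shift c N s k = trans (cong (_+ convolve c N s k) (ℤ.*-zeroˡ (s (suc k)))) (ℤ.+-identityˡ _)

convolve-−ᶜ : ∀ c d N s k → convolve (λ j → c j - d j) N s k ≡ convolve c N s k - convolve d N s k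
convolve-−ᶜ c d N s k =
  trans (Σℤ-cong (suc N) {G = λ j → c j * s (k ∸ j) - d j * s (k ∸ j)}
                 (λ j _ → trans (ℤ.*-distribʳ-+ (s (k ∸ j)) (c j) (- d j))
                                (cong (_+_ (c j * s (k ∸ j))) (sym (ℤ.neg-distribˡ-* (d j) (s (k ∸ j)))))))
        (Σℤ-− (suc N) (λ j → c j * s (k ∸ j)) (λ j → d j * s (k ∸ j)))

convolve-*ᶜ : ∀ m c N s k → convolve (λ j → m * c j) N s k ≡ m * convolve c N s k
convolve-*ᶜ m c N s k =
  trans (Σℤ-cong (suc N) (λ j _ → ℤ.*-assoc m (c j) (s (k ∸ j)))) (Σℤ-* (suc N) m (λ j → c j * s (k ∸ j)))

double : ℕ → ℕ
double zero    = zero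
double (suc i) = suc (suc (double i))

-- pathPoly p j is the coefficient of λ^(p ∸ j) in the characteristic polynomial P_p of the path
-- on p vertices: P₀ = 1, P₁ = λ, P_{p+2} = λ P_{p+1} − P_p.  Reading a coefficient sequence one
-- degree higher is shift.
pathPoly : ℕ → ℕ → ℤ
pathPoly (suc (suc p)) j       = pathPoly (suc p) j - shift (shift (pathPoly p)) j
pathPoly _             zero    = + 1
pathPoly _             (suc j) = + 0

pathPoly-odd : ∀ p i → pathPoly p (suc (double i)) ≡ + 0
pathPoly-odd zero          i       = refl
pathPoly-odd (suc zero)    i       = refl
pathPoly-odd (suc (suc p)) zero    = cong (_- + 0) (pathPoly-odd (suc p) 0)
pathPoly-odd (suc (suc p)) (suc i) = cong₂ _-_ (pathPoly-odd (suc p) (suc i)) (pathPoly-odd p i)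

pascal-∸ : ∀ p i → (suc p ∸ i) C suc i ≡ (p ∸ i) C i ℕ.+ (p ∸ i) C suc i
pascal-∸ p i with i ℕ.≤? p
... | yes i≤p = trans (cong (_C suc i) (ℕ.+-∸-assoc 1 i≤p)) (sym (nCk+nC[k+1]≡[n+1]C[k+1] (p ∸ i) i))
... | no  i≰p with ℕ.≰⇒> i≰p
...   | p<i@(s≤s _) rewrite ℕ.m≤n⇒m∸n≡0 p<i | ℕ.m≤n⇒m∸n≡0 (ℕ.<⇒≤ p<i) = refl

pathPoly-even : ∀ p i → pathPoly p (double i) ≡ sgn i * + ((p ∸ i) C i)
pathPoly-even zero          zero    = refl
pathPoly-even zero          (suc i) = sym (ℤ.*-zeroʳ (sgn (suc i)))
pathPoly-even (suc zero)    zero    = refl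
pathPoly-even (suc zero)    (suc i) rewrite ℕ.0∸n≡0 i = sym (ℤ.*-zeroʳ (sgn (suc i)))
pathPoly-even (suc (suc p)) zero    = cong (_- + 0) (pathPoly-even (suc p) 0)
pathPoly-even (suc (suc p)) (suc i) = begin
  pathPoly (suc p) (double (suc i)) - pathPoly p (double i)   ≡⟨ cong₂ _-_ (pathPoly-even (suc p) (suc i)) (pathPoly-even p i) ⟩
  - sgn i * + ((p ∸ i) C suc i) - sgn i * + ((p ∸ i) C i)     ≡⟨ collect (sgn i) (+ ((p ∸ i) C suc i)) (+ ((p ∸ i) C i)) ⟩
  - sgn i * + ((p ∸ i) C i ℕ.+ (p ∸ i) C suc i)                ≡⟨ cong (λ x → - sgn i * + x) (sym (pascal-∸ p i)) ⟩
  - sgn i * + ((suc p ∸ i) C suc i)                            ∎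
  where
  open ≡-Reasoning
  collect : ∀ s a b → - s * a - s * b ≡ - s * (b + a)
  collect = solve-∀

pathPoly-vanishes : ∀ p j → p < j → pathPoly p j ≡ + 0
pathPoly-vanishes zero          (suc j)       _ = refl
pathPoly-vanishes (suc zero)    (suc j)       _ = refl
pathPoly-vanishes (suc (suc p)) (suc (suc j)) (s≤s (s≤s p<j)) =
  cong₂ _-_ (pathPoly-vanishes (suc p) (suc (suc j)) (s≤s (ℕ.m≤n⇒m≤1+n p<j))) (pathPoly-vanishes p j p<j)

pathPoly-recurrence : ∀ p s k →
  convolve (pathPoly (suc (suc p))) (suc (suc p)) s (suc (suc k)) ≡
  convolve (pathPoly (suc p)) (suc p) s (suc (suc k)) - convolve (pathPoly p) p s k
pathPoly-recurrence p s k = begin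
  convolve (pathPoly (suc (suc p))) (suc (suc p)) s (suc (suc k))
    ≡⟨ convolve-−ᶜ (pathPoly (suc p)) (shift (shift (pathPoly p))) (suc (suc p)) s (suc (suc k)) ⟩
  convolve (pathPoly (suc p)) (suc (suc p)) s (suc (suc k)) - convolve (shift (shift (pathPoly p))) (suc (suc p)) s (suc (suc k))
    ≡⟨ cong₂ _-_ (convolve-truncate s (suc (suc k)) (ℕ.n≤1+n (suc p)) (pathPoly-vanishes (suc p)))
                 (trans (convolve-shift (shift (pathPoly p)) (suc p) s (suc k)) (convolve-shift (pathPoly p) p s k)) ⟩
  convolve (pathPoly (suc p)) (suc p) s (suc (suc k)) - convolve (pathPoly p) p s k
    ∎
  where open ≡-Reasoning

-- P_{D+1} − r P_D: expanding det(λ − A) along the end vertex when it carries r loops.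
loopedPathPoly : ℕ → ℕ → ℕ → ℤ
loopedPathPoly D r j = pathPoly (suc D) j - + r * shift (pathPoly D) j

loopedPathPoly-vanishes : ∀ D r j → suc D < j → loopedPathPoly D r j ≡ + 0
loopedPathPoly-vanishes D r (suc j) (s≤s D<j) =
  trans (cong₂ (λ a b → a - + r * b) (pathPoly-vanishes (suc D) (suc j) (s≤s D<j)) (pathPoly-vanishes D j D<j))
        (cong (λ x → + 0 - x) (ℤ.*-zeroʳ (+ r)))

-- One step of walking on the path 0 — 1 — ⋯ — D with r loops at D; pathWalks counts walks
-- through t vertices, with the same junk value at t = 0 as w.
pathStep : (D r : ℕ) → (ℕ → ℕ) → ℕ → ℕ
pathStep D r g zero    = g 1
pathStep D r g (suc c) = g c ℕ.+ (if suc c ℕ.<ᵇ D then g (suc (suc c)) else r ℕ.* g D)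

pathWalks : (D r : ℕ) → ℕ → ℕ → ℕ
pathWalks D r zero          c = 1
pathWalks D r (suc zero)    c = 1
pathWalks D r (suc (suc t)) c = pathStep D r (pathWalks D r (suc t)) c

pathStep-inner : ∀ D r g c → suc c < D → pathStep D r g (suc c) ≡ g c ℕ.+ g (suc (suc c))
pathStep-inner D r g c c<D with suc c ℕ.<ᵇ D | ℕ.<⇒<ᵇ c<D
... | true | _ = refl

pathStep-end : ∀ D r g → pathStep (suc D) r g (suc D) ≡ g D ℕ.+ r ℕ.* g (suc D)
pathStep-end D r g with D ℕ.<ᵇ D | ℕ.<ᵇ⇒< D D
... | true  | D<D = ⊥-elim (ℕ.<-irrefl refl (D<D _))
... | false | _   = refl

boundedPairInduction : ∀ {P : ℕ → Set} D → P 0 → P 1 →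
  (∀ j → suc j < D → P j → P (suc j) → P (suc (suc j))) → ∀ j → j ≤ D → P j
boundedPairInduction {P} D P0 P1 step = λ { zero _ → P0 ; (suc j) j<D → proj₂ (pair j j<D) }
  where
  pair : ∀ j → suc j ≤ D → P j × P (suc j)
  pair zero          _     = P0 , P1
  pair (suc j) j+1<D with pair j (ℕ.<⇒≤ j+1<D)
  ... | Pj , Pj+1 = Pj+1 , step j j+1<D Pj Pj+1

module Walks (D r : ℕ) where

  walks : ℕ → ℕ → ℤ
  walks c t = + pathWalks D r t c

  walks-inner : ∀ c t → suc c < D → walks (suc (suc c)) (suc t) ≡ walks (suc c) (suc (suc t)) - walks c (suc t)
  walks-inner c t c<D = begin
    walks (suc (suc c)) (suc t)
      ≡⟨ add-sub (walks c (suc t)) (walks (suc (suc c)) (suc t)) ⟩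
    (walks c (suc t) + walks (suc (suc c)) (suc t)) - walks c (suc t)
      ≡⟨ cong (λ x → + x - walks c (suc t)) (sym (pathStep-inner D r _ c c<D)) ⟩
    walks (suc c) (suc (suc t)) - walks c (suc t)
      ∎
    where
    open ≡-Reasoning
    add-sub : ∀ a b → b ≡ (a + b) - a
    add-sub = solve-∀

  walks-annihilated : ∀ {c N} → Annihilates c N (walks 0) → ∀ j → j ≤ D → Annihilates c N (walks j)
  walks-annihilated {c} {N} ann₀ = boundedPairInduction D ann₀ ann₁ step
    where
    ann₁ : Annihilates c N (walks 1)
    ann₁ = annihilates-cong (λ { (suc t) _ → refl }) (annihilates-shift ann₀)
    step : ∀ j → suc j < D → Annihilates c N (walks j) → Annihilates c N (walks (suc j)) → Annihilates c N (walks (suc (suc j)))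
    step j j<D annⱼ annⱼ₊₁ =
      annihilates-cong (λ { (suc t) _ → sym (walks-inner j t j<D) }) (annihilates-− (annihilates-shift annⱼ₊₁) annⱼ)

  walks-as-convolve : ∀ j → j ≤ D → ∀ t → walks j (suc t) ≡ convolve (pathPoly j) j (walks 0) (j ℕ.+ suc t)
  walks-as-convolve = boundedPairInduction D base₀ base₁ step
    where
    P : ℕ → Set
    P j = ∀ t → walks j (suc t) ≡ convolve (pathPoly j) j (walks 0) (j ℕ.+ suc t)
    base₀ : P 0
    base₀ t = sym (trans (ℤ.+-identityʳ (+ 1 * walks 0 (suc t))) (ℤ.*-identityˡ (walks 0 (suc t))))
    base₁ : P 1
    base₁ t = unit (walks 1 (suc t)) (walks 0 (suc t))
      where unit : ∀ a b → a ≡ + 1 * a + (+ 0 * b + + 0)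
            unit = solve-∀
    step : ∀ j → suc j < D → P j → P (suc j) → P (suc (suc j))
    step j j<D Pⱼ Pⱼ₊₁ t = begin
      walks (suc (suc j)) (suc t)                         ≡⟨ walks-inner j t j<D ⟩
      walks (suc j) (suc (suc t)) - walks j (suc t)       ≡⟨ cong₂ _-_ (Pⱼ₊₁ (suc t)) (Pⱼ t) ⟩
      convolve (pathPoly (suc j)) (suc j) (walks 0) (suc j ℕ.+ suc (suc t)) - convolve (pathPoly j) j (walks 0) (j ℕ.+ suc t)
        ≡⟨ cong (λ i → convolve (pathPoly (suc j)) (suc j) (walks 0) (suc i) - convolve (pathPoly j) j (walks 0) (j ℕ.+ suc t))
                (ℕ.+-suc j (suc t)) ⟩
      convolve (pathPoly (suc j)) (suc j) (walks 0) (suc (suc (j ℕ.+ suc t))) - convolve (pathPoly j) j (walks 0) (j ℕ.+ suc t)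
        ≡⟨ sym (pathPoly-recurrence j (walks 0) (j ℕ.+ suc t)) ⟩
      convolve (pathPoly (suc (suc j))) (suc (suc j)) (walks 0) (suc (suc j) ℕ.+ suc t) ∎
      where open ≡-Reasoning


loopedPathPoly-convolve : ∀ D r s m →
  convolve (loopedPathPoly (suc D) r) (suc (suc D)) s (suc (suc m)) ≡
  (convolve (pathPoly (suc D)) (suc D) s (suc (suc m)) - convolve (pathPoly D) D s m)
    - + r * convolve (pathPoly (suc D)) (suc D) s (suc m)
loopedPathPoly-convolve D r s m = begin
  convolve (loopedPathPoly (suc D) r) (suc (suc D)) s (suc (suc m))
    ≡⟨ convolve-−ᶜ (pathPoly (suc (suc D))) loop (suc (suc D)) s (suc (suc m)) ⟩
  convolve (pathPoly (suc (suc D))) (suc (suc D)) s (suc (suc m)) - convolve loop (suc (suc D)) s (suc (suc m))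
    ≡⟨ cong₂ _-_ (pathPoly-recurrence D s m)
                 (trans (convolve-*ᶜ (+ r) (shift (pathPoly (suc D))) (suc (suc D)) s (suc (suc m)))
                        (cong (+ r *_) (convolve-shift (pathPoly (suc D)) (suc D) s (suc m)))) ⟩
  (convolve (pathPoly (suc D)) (suc D) s (suc (suc m)) - convolve (pathPoly D) D s m)
    - + r * convolve (pathPoly (suc D)) (suc D) s (suc m) ∎
  where
  open ≡-Reasoning
  loop : ℕ → ℤ
  loop j = + r * shift (pathPoly (suc D)) j

walks₀-annihilated : ∀ D r → Annihilates (loopedPathPoly (suc D) r) (suc (suc D)) (Walks.walks (suc D) r 0)
walks₀-annihilated D r = annihilates-from λ t → begin
  convolve (loopedPathPoly (suc D) r) (suc (suc D)) z (suc (suc (D ℕ.+ suc t)))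
    ≡⟨ loopedPathPoly-convolve D r z (D ℕ.+ suc t) ⟩
  (convolve (pathPoly (suc D)) (suc D) z (suc (suc (D ℕ.+ suc t))) - convolve (pathPoly D) D z (D ℕ.+ suc t))
    - + r * convolve (pathPoly (suc D)) (suc D) z (suc (D ℕ.+ suc t))
    ≡⟨ cong₂ (λ a b → a - + r * b)
             (cong₂ _-_ (trans (cong (λ i → convolve (pathPoly (suc D)) (suc D) z (suc i)) (sym (ℕ.+-suc D (suc t))))
                               (sym (walks-as-convolve (suc D) ℕ.≤-refl (suc t))))
                        (sym (walks-as-convolve D (ℕ.n≤1+n D) t)))
             (sym (walks-as-convolve (suc D) ℕ.≤-refl t)) ⟩
  (walks (suc D) (suc (suc t)) - walks D (suc t)) - + r * walks (suc D) (suc t)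
    ≡⟨ cong (λ x → (x - walks D (suc t)) - + r * walks (suc D) (suc t)) (walks-top t) ⟩
  ((walks D (suc t) + + r * walks (suc D) (suc t)) - walks D (suc t)) - + r * walks (suc D) (suc t)
    ≡⟨ add-sub-sub (walks D (suc t)) (+ r * walks (suc D) (suc t)) ⟩
  + 0 ∎
  where
  open Walks (suc D) r
  open ≡-Reasoning
  z : ℕ → ℤ
  z = walks 0
  add-sub-sub : ∀ a b → (a + b) - a - b ≡ + 0
  add-sub-sub = solve-∀
  walks-top : ∀ t → walks (suc D) (suc (suc t)) ≡ walks D (suc t) + + r * walks (suc D) (suc t)
  walks-top t = trans (cong +_ (pathStep-end D r (pathWalks (suc D) r (suc t))))
                      (trans (ℤ.pos-+ (pathWalks (suc D) r (suc t) D) _) (cong (_+_ (walks D (suc t))) (ℤ.pos-* r _)))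

if-≟-yes : ∀ {A : Set} {x y} (a b : A) → x ≡ y → (if does (x ℕ.≟ y) then a else b) ≡ a
if-≟-yes a b x≡y = cong (λ t → if t then a else b) (dec-true (_ ℕ.≟ _) x≡y)

if-≟-no : ∀ {A : Set} {x y} (a b : A) → x ≢ y → (if does (x ℕ.≟ y) then a else b) ≡ b
if-≟-no a b x≢y = cong (λ t → if t then a else b) (dec-false (_ ℕ.≟ _) x≢y)

sumℤ-applyUpTo : ∀ K (h : ℕ → ℤ) (f : ℕ → ℕ) → sumℤ (map h (map suc (applyUpTo f K))) ≡ Σℤ K (h ∘ suc ∘ f)
sumℤ-applyUpTo zero    h f = refl
sumℤ-applyUpTo (suc K) h f = cong (_+_ (h (suc (f 0)))) (sumℤ-applyUpTo K h (f ∘ suc))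

double≡2* : ∀ i → double i ≡ 2 ℕ.* i
double≡2* zero    = refl
double≡2* (suc i) = cong suc (trans (cong suc (double≡2* i)) (sym (ℕ.+-suc i (i ℕ.+ 0))))

double≢odd : ∀ a b → double a ≢ suc (double b)
double≢odd (suc a) (suc b) e = double≢odd a b (ℕ.suc-injective (ℕ.suc-injective e))

parity : ∀ j → ∃ λ i → j ≡ double i ⊎ j ≡ suc (double i)
parity zero = 0 , inj₁ refl
parity (suc j) with parity j
... | i , inj₁ j≡2i   = i , inj₂ (cong suc j≡2i)
... | i , inj₂ j≡2i+1 = suc i , inj₁ (cong suc j≡2i+1)

-- The summand k = suc i of P_n contributes to α_j = [λ^(n ∸ j)] exactly when 2 i = s + j,
-- s = 0 for its λ^(n+2−2k) part and s = 1 for its λ^(n+3−2k) part.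
module _ {n j : ℕ} (j≤n : j ≤ n) where

  exponent-shift : ∀ s → n ∸ j ℕ.+ (2 ℕ.+ (s ℕ.+ j)) ≡ n ℕ.+ (2 ℕ.+ s)
  exponent-shift s = trans (rearrange (n ∸ j) s j) (cong (ℕ._+ (2 ℕ.+ s)) (ℕ.m∸n+n≡m j≤n))
    where rearrange : ∀ a s j → a ℕ.+ (2 ℕ.+ (s ℕ.+ j)) ≡ (a ℕ.+ j) ℕ.+ (2 ℕ.+ s)
          rearrange = ℕ.solve-∀

  exponent-hit : ∀ s i → double i ≡ s ℕ.+ j → n ∸ j ℕ.+ 2 ℕ.* suc i ≡ n ℕ.+ (2 ℕ.+ s)
  exponent-hit s i 2i≡s+j =
    trans (cong (n ∸ j ℕ.+_) (trans (sym (double≡2* (suc i))) (cong (suc ∘ suc) 2i≡s+j)))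
          (exponent-shift s)

  exponent-miss : ∀ s i → n ∸ j ℕ.+ 2 ℕ.* suc i ≡ n ℕ.+ (2 ℕ.+ s) → double i ≡ s ℕ.+ j
  exponent-miss s i hit = ℕ.suc-injective (ℕ.suc-injective (ℕ.+-cancelˡ-≡ (n ∸ j) _ _
    (trans (cong (n ∸ j ℕ.+_) (double≡2* (suc i))) (trans hit (sym (exponent-shift s))))))

module _ (e T : ℕ) (s c : ℕ → ℤ) where

  Σℤ-when-hit : ∀ K i₀ → e ℕ.+ 2 ℕ.* suc i₀ ≡ T → (K ≤ i₀ → c i₀ ≡ + 0) →
    Σℤ K (λ i → s i * when (e ℕ.+ 2 ℕ.* suc i) T (c i)) ≡ s i₀ * c i₀
  Σℤ-when-hit K i₀ hit far = trans (Σℤ-single K i₀ off (λ K≤i₀ → trans at-i₀ (s*c≡0 K≤i₀))) at-i₀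
    where
    at-i₀ : s i₀ * when (e ℕ.+ 2 ℕ.* suc i₀) T (c i₀) ≡ s i₀ * c i₀
    at-i₀ = cong (s i₀ *_) (if-≟-yes (c i₀) (+ 0) hit)
    s*c≡0 : K ≤ i₀ → s i₀ * c i₀ ≡ + 0
    s*c≡0 K≤i₀ = trans (cong (s i₀ *_) (far K≤i₀)) (ℤ.*-zeroʳ (s i₀))
    off : ∀ i → i ≢ i₀ → s i * when (e ℕ.+ 2 ℕ.* suc i) T (c i) ≡ + 0
    off i i≢i₀ = trans (cong (s i *_) (if-≟-no (c i) (+ 0) λ hitᵢ →
        i≢i₀ (ℕ.suc-injective (ℕ.*-cancelˡ-≡ (suc i) (suc i₀) 2 (ℕ.+-cancelˡ-≡ e _ _ (trans hitᵢ (sym hit)))))))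
      (ℤ.*-zeroʳ (s i))

  Σℤ-when-miss : ∀ K → (∀ i → e ℕ.+ 2 ℕ.* suc i ≢ T) →
    Σℤ K (λ i → s i * when (e ℕ.+ 2 ℕ.* suc i) T (c i)) ≡ + 0
  Σℤ-when-miss K miss = Σℤ-zero K (λ i → trans (cong (s i *_) (if-≟-no (c i) (+ 0) (miss i))) (ℤ.*-zeroʳ (s i)))

binomial-vanishes : ∀ a i → (a ℕ.+ a) / 4 < i → (a ∸ i) C i ≡ 0
binomial-vanishes a i q<i with i ℕ.+ i ℕ.≤? a
... | no  i+i≰a = k>n⇒nCk≡0 (ℕ.m<n+o⇒m∸n<o a i {{ℕ.>-nonZero (ℕ.≤-<-trans z≤n q<i)}} (ℕ.≰⇒> i+i≰a))
... | yes i+i≤a = ⊥-elim (ℕ.<⇒≱ q<i (begin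
  i                  ≡⟨ m*n/n≡m i 4 ⟨
  i ℕ.* 4 / 4        ≤⟨ /-monoˡ-≤ 4 (ℕ.≤-trans (ℕ.≤-reflexive (four-times i))
                                                (ℕ.+-mono-≤ i+i≤a i+i≤a)) ⟩
  (a ℕ.+ a) / 4      ∎))
  where open ℕ.≤-Reasoning
        four-times : ∀ i → i ℕ.* 4 ≡ (i ℕ.+ i) ℕ.+ (i ℕ.+ i)
        four-times = ℕ.solve-∀

coeffP-even : ∀ n e → n % 2 ≡ 0 → coeffP n e ≡
  Σℤ ((n ℕ.+ 2) / 4 ℕ.+ 1) (λ i → sgn i * when (e ℕ.+ 2 ℕ.* suc i) (n ℕ.+ 2) (+ ((n / 2 ℕ.+ 2 ∸ suc i) C i)))
coeffP-even n e n%2≡0 rewrite n%2≡0 = sumℤ-applyUpTo ((n ℕ.+ 2) / 4 ℕ.+ 1) _ (λ i → i)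

coeffP-odd : ∀ n e → n % 2 ≡ 1 → coeffP n e ≡
  Σℤ ((n ℕ.+ 2) / 4 ℕ.+ 2) (λ i → sgn i *
    (when (e ℕ.+ 2 ℕ.* suc i) (n ℕ.+ 2) (+ binom ((n ℕ.+ 3) / 2 ∸ suc i) (+ suc i - + 1))
     + when (e ℕ.+ 2 ℕ.* suc i) (n ℕ.+ 3) (+ binom ((n ℕ.+ 3) / 2 ∸ suc i) (+ suc i - + 2))))
coeffP-odd n e n%2≡1 rewrite n%2≡1 = sumℤ-applyUpTo ((n ℕ.+ 2) / 4 ℕ.+ 2) _ (λ i → i)

[D+D+r]%2≡r%2 : ∀ D r → (D ℕ.+ D ℕ.+ r) % 2 ≡ r % 2
[D+D+r]%2≡r%2 D r = trans (cong (_% 2) (twice D r)) ([m+kn]%n≡m%n r D 2)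
  where twice : ∀ D r → D ℕ.+ D ℕ.+ r ≡ r ℕ.+ D ℕ.* 2
        twice = ℕ.solve-∀

[D+D]/2≡D : ∀ D → (D ℕ.+ D ℕ.+ 0) / 2 ≡ D
[D+D]/2≡D D = trans (cong (_/ 2) (twice D)) (m*n/n≡m D 2)
  where twice : ∀ D → D ℕ.+ D ℕ.+ 0 ≡ D ℕ.* 2
        twice = ℕ.solve-∀

[D+D+4]/2≡D+2 : ∀ D → (D ℕ.+ D ℕ.+ 1 ℕ.+ 3) / 2 ≡ D ℕ.+ 2
[D+D+4]/2≡D+2 D = trans (cong (_/ 2) (twice D)) (m*n/n≡m (D ℕ.+ 2) 2)
  where twice : ∀ D → D ℕ.+ D ℕ.+ 1 ℕ.+ 3 ≡ (D ℕ.+ 2) ℕ.* 2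
        twice = ℕ.solve-∀

below-quarter : ∀ {x y i} m → x ≤ y → y / 4 ℕ.+ suc m ≤ i → x / 4 < i
below-quarter {y = y} m x≤y y/4+m<i =
  ℕ.≤-trans (s≤s (/-monoˡ-≤ 4 x≤y)) (ℕ.≤-trans (ℕ.≤-reflexive (ℕ.+-comm 1 (y / 4)))
    (ℕ.≤-trans (ℕ.+-monoʳ-≤ (y / 4) (s≤s z≤n)) y/4+m<i))

shift-pathPoly-even : ∀ p i → shift (pathPoly p) (double i) ≡ + 0
shift-pathPoly-even p zero    = refl
shift-pathPoly-even p (suc i) = pathPoly-odd p i

α-even : ∀ D j → j ≤ D ℕ.+ D ℕ.+ 0 → α (D ℕ.+ D ℕ.+ 0) j ≡ pathPoly (suc D) j
α-even D j j≤n with parity j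
... | i₀ , inj₁ refl = begin
  α n (double i₀)                      ≡⟨ coeffP-even n (n ∸ double i₀) ([D+D+r]%2≡r%2 D 0) ⟩
  Σℤ K (λ i → sgn i * when (n ∸ double i₀ ℕ.+ 2 ℕ.* suc i) (n ℕ.+ 2) (c i))
      ≡⟨ Σℤ-when-hit _ _ sgn c K i₀ (exponent-hit j≤n 0 i₀ refl)
                     (λ K≤i₀ → trans (c≡ i₀) (cong +_ (vanishes K≤i₀))) ⟩
  sgn i₀ * c i₀                        ≡⟨ cong (sgn i₀ *_) (c≡ i₀) ⟩
  sgn i₀ * + ((suc D ∸ i₀) C i₀)       ≡⟨ pathPoly-even (suc D) i₀ ⟨
  pathPoly (suc D) (double i₀)         ∎
  where
  open ≡-Reasoning
  n = D ℕ.+ D ℕ.+ 0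
  K = (n ℕ.+ 2) / 4 ℕ.+ 1
  c : ℕ → ℤ
  c i = + ((n / 2 ℕ.+ 2 ∸ suc i) C i)
  c≡ : ∀ i → c i ≡ + ((suc D ∸ i) C i)
  c≡ i = cong (λ h → + ((h ∸ suc i) C i)) (trans (cong (ℕ._+ 2) ([D+D]/2≡D D)) (ℕ.+-comm D 2))
  vanishes : K ≤ i₀ → (suc D ∸ i₀) C i₀ ≡ 0
  vanishes K≤i₀ = binomial-vanishes (suc D) i₀ (below-quarter 0 (ℕ.≤-reflexive (two-more D)) K≤i₀)
    where two-more : ∀ D → suc D ℕ.+ suc D ≡ D ℕ.+ D ℕ.+ 0 ℕ.+ 2
          two-more = ℕ.solve-∀
... | i₀ , inj₂ refl = begin
  α n (suc (double i₀))                ≡⟨ coeffP-even n (n ∸ suc (double i₀)) ([D+D+r]%2≡r%2 D 0) ⟩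
  Σℤ K (λ i → sgn i * when (n ∸ suc (double i₀) ℕ.+ 2 ℕ.* suc i) (n ℕ.+ 2) (+ ((n / 2 ℕ.+ 2 ∸ suc i) C i)))
      ≡⟨ Σℤ-when-miss _ _ sgn _ K (λ i hit → double≢odd i i₀ (exponent-miss j≤n 0 i hit)) ⟩
  + 0                                  ≡⟨ pathPoly-odd (suc D) i₀ ⟨
  pathPoly (suc D) (suc (double i₀))   ∎
  where
  open ≡-Reasoning
  n = D ℕ.+ D ℕ.+ 0
  K = (n ℕ.+ 2) / 4 ℕ.+ 1

module _ (D : ℕ) where

  private
    n K : ℕ
    n = D ℕ.+ D ℕ.+ 1
    K = (n ℕ.+ 2) / 4 ℕ.+ 2

    c₁ c₂ : ℕ → ℤ
    c₁ i = + binom ((n ℕ.+ 3) / 2 ∸ suc i) (+ suc i - + 1)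
    c₂ i = + binom ((n ℕ.+ 3) / 2 ∸ suc i) (+ suc i - + 2)

    terms : ℕ → (ℕ → ℤ) → ℕ → ℤ
    terms s c j = Σℤ K (λ i → sgn i * when (n ∸ j ℕ.+ 2 ℕ.* suc i) (n ℕ.+ (2 ℕ.+ s)) (c i))

    [n+3]/2≡2+D : (n ℕ.+ 3) / 2 ≡ 2 ℕ.+ D
    [n+3]/2≡2+D = trans ([D+D+4]/2≡D+2 D) (ℕ.+-comm D 2)

  α-odd-split : ∀ j → α n j ≡ terms 0 c₁ j + terms 1 c₂ j
  α-odd-split j = trans (coeffP-odd n (n ∸ j) ([D+D+r]%2≡r%2 D 1))
    (trans (Σℤ-cong K (λ i _ → ℤ.*-distribˡ-+ (sgn i) (when (x i) (n ℕ.+ 2) (c₁ i)) (when (x i) (n ℕ.+ 3) (c₂ i))))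
           (Σℤ-+ K (λ i → sgn i * when (x i) (n ℕ.+ 2) (c₁ i)) (λ i → sgn i * when (x i) (n ℕ.+ 3) (c₂ i))))
    where x : ℕ → ℕ
          x i = n ∸ j ℕ.+ 2 ℕ.* suc i

  α-odd-at-even : ∀ i₀ → double i₀ ≤ n →
    terms 0 c₁ (double i₀) + terms 1 c₂ (double i₀) ≡ pathPoly (suc D) (double i₀)
  α-odd-at-even i₀ j≤n = begin
    terms 0 c₁ (double i₀) + terms 1 c₂ (double i₀)
      ≡⟨ cong₂ _+_ (Σℤ-when-hit _ _ sgn c₁ K i₀ (exponent-hit j≤n 0 i₀ refl)
                      (λ K≤i₀ → trans (c₁≡ i₀) (cong +_ (binomial-vanishes (suc D) i₀ (below-quarter 1 sD+sD≤n+2 K≤i₀)))))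
                   (Σℤ-when-miss _ _ sgn c₂ K (λ i hit → double≢odd i i₀ (exponent-miss j≤n 1 i hit))) ⟩
    sgn i₀ * c₁ i₀ + + 0               ≡⟨ ℤ.+-identityʳ _ ⟩
    sgn i₀ * c₁ i₀                     ≡⟨ cong (sgn i₀ *_) (c₁≡ i₀) ⟩
    sgn i₀ * + ((suc D ∸ i₀) C i₀)     ≡⟨ pathPoly-even (suc D) i₀ ⟨
    pathPoly (suc D) (double i₀)       ∎
    where
    open ≡-Reasoning
    c₁≡ : ∀ i → c₁ i ≡ + ((suc D ∸ i) C i)
    c₁≡ i = cong (λ y → + ((y ∸ suc i) C i)) [n+3]/2≡2+D
    sD+sD≤n+2 : suc D ℕ.+ suc D ≤ n ℕ.+ 2
    sD+sD≤n+2 = ℕ.≤-trans (ℕ.n≤1+n _) (ℕ.≤-reflexive (three-more D))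
      where three-more : ∀ D → suc (suc D ℕ.+ suc D) ≡ D ℕ.+ D ℕ.+ 1 ℕ.+ 2
            three-more = ℕ.solve-∀

  α-odd-at-odd : ∀ i₀ → suc (double i₀) ≤ n →
    terms 0 c₁ (suc (double i₀)) + terms 1 c₂ (suc (double i₀)) ≡ - pathPoly D (double i₀)
  α-odd-at-odd i₀ j≤n = begin
    terms 0 c₁ (suc (double i₀)) + terms 1 c₂ (suc (double i₀))
      ≡⟨ cong₂ _+_ (Σℤ-when-miss _ _ sgn c₁ K (λ i hit → double≢odd i i₀ (exponent-miss j≤n 0 i hit)))
                   (Σℤ-when-hit _ _ sgn c₂ K (suc i₀) (exponent-hit j≤n 1 (suc i₀) refl)
                      (λ K≤1+i₀ → trans (c₂≡ i₀)
                         (cong +_ (binomial-vanishes D i₀ (below-quarter 0 D+D≤n+2 (K≤1+i₀⇒ K≤1+i₀)))))) ⟩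
    + 0 + sgn (suc i₀) * c₂ (suc i₀)   ≡⟨ ℤ.+-identityˡ _ ⟩
    sgn (suc i₀) * c₂ (suc i₀)         ≡⟨ cong (sgn (suc i₀) *_) (c₂≡ i₀) ⟩
    - sgn i₀ * + ((D ∸ i₀) C i₀)       ≡⟨ ℤ.neg-distribˡ-* (sgn i₀) _ ⟨
    - (sgn i₀ * + ((D ∸ i₀) C i₀))     ≡⟨ cong -_ (pathPoly-even D i₀) ⟨
    - pathPoly D (double i₀)           ∎
    where
    open ≡-Reasoning
    c₂≡ : ∀ i → c₂ (suc i) ≡ + ((D ∸ i) C i)
    c₂≡ i = cong (λ y → + ((y ∸ suc (suc i)) C i)) [n+3]/2≡2+D
    D+D≤n+2 : D ℕ.+ D ≤ n ℕ.+ 2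
    D+D≤n+2 = ℕ.≤-trans (ℕ.m≤m+n (D ℕ.+ D) 1) (ℕ.m≤m+n n 2)
    K≤1+i₀⇒ : K ≤ suc i₀ → (n ℕ.+ 2) / 4 ℕ.+ 1 ≤ i₀
    K≤1+i₀⇒ K≤1+i₀ = ℕ.≤-pred (ℕ.≤-trans (ℕ.≤-reflexive (sym (ℕ.+-suc ((n ℕ.+ 2) / 4) 1))) K≤1+i₀)

  α-odd : ∀ j → j ≤ n → α n j ≡ pathPoly (suc D) j - shift (pathPoly D) j
  α-odd j j≤n with parity j
  ... | i₀ , inj₁ refl = begin
    α n (double i₀)
      ≡⟨ trans (α-odd-split (double i₀)) (α-odd-at-even i₀ j≤n) ⟩
    pathPoly (suc D) (double i₀)
      ≡⟨ ℤ.+-identityʳ _ ⟨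
    pathPoly (suc D) (double i₀) - + 0
      ≡⟨ cong (_-_ (pathPoly (suc D) (double i₀))) (shift-pathPoly-even D i₀) ⟨
    pathPoly (suc D) (double i₀) - shift (pathPoly D) (double i₀)
      ∎
    where open ≡-Reasoning
  ... | i₀ , inj₂ refl = begin
    α n (suc (double i₀))
      ≡⟨ trans (α-odd-split (suc (double i₀))) (α-odd-at-odd i₀ j≤n) ⟩
    - pathPoly D (double i₀)
      ≡⟨ ℤ.+-identityˡ _ ⟨
    + 0 - pathPoly D (double i₀)
      ≡⟨ cong (_- pathPoly D (double i₀)) (pathPoly-odd (suc D) i₀) ⟨
    pathPoly (suc D) (suc (double i₀)) - shift (pathPoly D) (suc (double i₀))
      ∎
    where open ≡-Reasoning

α≡loopedPathPoly : ∀ D r j → r ≤ 1 → j ≤ D ℕ.+ D ℕ.+ r → α (D ℕ.+ D ℕ.+ r) j ≡ loopedPathPoly D r j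
α≡loopedPathPoly D .0 j z≤n       j≤n =
  trans (α-even D j j≤n)
        (sym (trans (cong (_-_ (pathPoly (suc D) j)) (ℤ.*-zeroˡ (shift (pathPoly D) j))) (ℤ.+-identityʳ _)))
α≡loopedPathPoly D .1 j (s≤s z≤n) j≤n =
  trans (α-odd D j j≤n) (cong (_-_ (pathPoly (suc D) j)) (sym (ℤ.*-identityˡ (shift (pathPoly D) j))))

Σℕ : ℕ → (ℕ → ℕ) → ℕ
Σℕ zero    G = 0
Σℕ (suc N) G = G 0 ℕ.+ Σℕ N (G ∘ suc)

ΣFin≡Σℕ : ∀ N (G : ℕ → ℕ) → ΣFin {N} (G ∘ toℕ) ≡ Σℕ N G
ΣFin≡Σℕ zero    G = refl
ΣFin≡Σℕ (suc N) G = cong (G 0 ℕ.+_) (ΣFin≡Σℕ N (G ∘ suc))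

ΣFin-cong : ∀ {N} {F G : Fin N → ℕ} → (∀ i → F i ≡ G i) → ΣFin F ≡ ΣFin G
ΣFin-cong {zero}  F≡G = refl
ΣFin-cong {suc N} F≡G = cong₂ ℕ._+_ (F≡G Fin.zero) (ΣFin-cong (F≡G ∘ Fin.suc))

Σℕ-zero : ∀ N (G : ℕ → ℕ) → (∀ i → i < N → G i ≡ 0) → Σℕ N G ≡ 0
Σℕ-zero zero    G G≡0 = refl
Σℕ-zero (suc N) G G≡0 = cong₂ ℕ._+_ (G≡0 0 (s≤s z≤n)) (Σℕ-zero N (G ∘ suc) (λ i i<N → G≡0 (suc i) (s≤s i<N)))

Σℕ-single : ∀ N (G : ℕ → ℕ) c → c < N → (∀ i → i < N → i ≢ c → G i ≡ 0) → Σℕ N G ≡ G c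
Σℕ-single (suc N) G zero    _         off =
  trans (cong (G 0 ℕ.+_) (Σℕ-zero N (G ∘ suc) (λ i i<N → off (suc i) (s≤s i<N) λ ()))) (ℕ.+-identityʳ (G 0))
Σℕ-single (suc N) G (suc c) (s≤s c<N) off =
  trans (cong (ℕ._+ Σℕ N (G ∘ suc)) (off 0 (s≤s z≤n) λ ()))
        (Σℕ-single N (G ∘ suc) c c<N (λ i i<N i≢c → off (suc i) (s≤s i<N) (i≢c ∘ ℕ.suc-injective)))

Σℕ-pair : ∀ N (G : ℕ → ℕ) c d → c < N → d < N → c ≢ d →
          (∀ i → i < N → i ≢ c → i ≢ d → G i ≡ 0) → Σℕ N G ≡ G c ℕ.+ G d
Σℕ-pair (suc N) G zero    zero    _         _         c≢d off = ⊥-elim (c≢d refl)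
Σℕ-pair (suc N) G zero    (suc d) _         (s≤s d<N) _   off =
  cong (G 0 ℕ.+_) (Σℕ-single N (G ∘ suc) d d<N (λ i i<N i≢d → off (suc i) (s≤s i<N) (λ ()) (i≢d ∘ ℕ.suc-injective)))
Σℕ-pair (suc N) G (suc c) zero    (s≤s c<N) _         _   off =
  trans (cong (G 0 ℕ.+_) (Σℕ-single N (G ∘ suc) c c<N (λ i i<N i≢c → off (suc i) (s≤s i<N) (i≢c ∘ ℕ.suc-injective) (λ ()))))
        (ℕ.+-comm (G 0) (G (suc c)))
Σℕ-pair (suc N) G (suc c) (suc d) (s≤s c<N) (s≤s d<N) c≢d off =
  trans (cong (ℕ._+ Σℕ N (G ∘ suc)) (off 0 (s≤s z≤n) (λ ()) (λ ())))
        (Σℕ-pair N (G ∘ suc) c d c<N d<N (c≢d ∘ cong suc)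
                 (λ i i<N i≢c i≢d → off (suc i) (s≤s i<N) (i≢c ∘ ℕ.suc-injective) (i≢d ∘ ℕ.suc-injective)))

∸-suc-involutive : ∀ {n x} → x < n → n ∸ suc (n ∸ suc x) ≡ x
∸-suc-involutive {n} {x} x<n = trans (sym (ℕ.pred[m∸n]≡m∸[1+n] n (n ∸ suc x))) (cong pred (ℕ.m∸[m∸n]≡n x<n))

∸-suc-step : ∀ {n x} → suc x < n → n ∸ suc x ≡ suc (n ∸ suc (suc x))
∸-suc-step = ℕ.+-∸-assoc 1

adj : ℕ → ℕ → ℕ → ℕ
adj n x y = if does (y ℕ.≟ x ℕ.+ 1) then 1 else if does ((x ℕ.+ 1) ℕ.+ (y ℕ.+ 1) ℕ.≟ n ℕ.+ 1) then 1 else 0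

module _ {n x y : ℕ} where

  mirror-equation : (x ℕ.+ 1) ℕ.+ (y ℕ.+ 1) ≡ n ℕ.+ 1 → y ≡ n ∸ suc x
  mirror-equation eq =
    trans (sym (ℕ.m+n∸m≡n (suc x) y)) (cong (_∸ suc x) (ℕ.+-cancelʳ-≡ 1 (suc x ℕ.+ y) n (trans (sym (shuffle x y)) eq)))
    where shuffle : ∀ x y → (x ℕ.+ 1) ℕ.+ (y ℕ.+ 1) ≡ suc x ℕ.+ y ℕ.+ 1
          shuffle = ℕ.solve-∀

  adj-succ : y ≡ suc x → adj n x y ≡ 1
  adj-succ y≡x+1 = if-≟-yes 1 _ (trans y≡x+1 (ℕ.+-comm 1 x))

  adj-mirror : x < n → y ≢ suc x → y ≡ n ∸ suc x → adj n x y ≡ 1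
  adj-mirror x<n y≢x+1 refl = trans (if-≟-no 1 _ (λ e → y≢x+1 (trans e (ℕ.+-comm x 1))))
    (if-≟-yes 1 0 (trans (shuffle x (n ∸ suc x)) (cong (ℕ._+ 1) (ℕ.m+[n∸m]≡n x<n))))
    where shuffle : ∀ x y → (x ℕ.+ 1) ℕ.+ (y ℕ.+ 1) ≡ suc x ℕ.+ y ℕ.+ 1
          shuffle = ℕ.solve-∀

  adj-other : y ≢ suc x → y ≢ n ∸ suc x → adj n x y ≡ 0
  adj-other y≢x+1 y≢mirror =
    trans (if-≟-no 1 _ (λ e → y≢x+1 (trans e (ℕ.+-comm x 1)))) (if-≟-no 1 0 (y≢mirror ∘ mirror-equation))

adjSum : ℕ → ℕ → (ℕ → ℕ) → ℕ
adjSum n x h = Σℕ n (λ y → adj n x y ℕ.* h y)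

module _ {n x : ℕ} (h : ℕ → ℕ) where

  private
    weight-1 : ∀ {y} → adj n x y ≡ 1 → adj n x y ℕ.* h y ≡ h y
    weight-1 {y} e = trans (cong (ℕ._* h y) e) (ℕ.+-identityʳ (h y))

    weight-0 : ∀ y → y ≢ suc x → y ≢ n ∸ suc x → adj n x y ℕ.* h y ≡ 0
    weight-0 y y≢x+1 y≢mirror = cong (ℕ._* h y) (adj-other {n} {x} {y} y≢x+1 y≢mirror)

  adjSum-last : suc x ≡ n → adjSum n x h ≡ h 0
  adjSum-last refl =
    trans (Σℕ-single n _ 0 (s≤s z≤n) (λ i i<n i≢0 → weight-0 i (ℕ.<⇒≢ i<n) (i≢0 ∘ flip trans mirror≡0)))
          (weight-1 (adj-mirror {n} {x} ℕ.≤-refl (λ ()) (sym mirror≡0)))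
    where mirror≡0 : n ∸ suc x ≡ 0
          mirror≡0 = ℕ.n∸n≡0 n

  adjSum-loop : suc x < n → suc x ≡ n ∸ suc x → adjSum n x h ≡ h (suc x)
  adjSum-loop x+1<n loop =
    trans (Σℕ-single n _ (suc x) x+1<n (λ i _ i≢x+1 → weight-0 i i≢x+1 (i≢x+1 ∘ flip trans (sym loop))))
          (weight-1 (adj-succ {n} {x} refl))

  adjSum-pair : suc x < n → suc x ≢ n ∸ suc x → adjSum n x h ≡ h (suc x) ℕ.+ h (n ∸ suc x)
  adjSum-pair x+1<n no-loop =
    trans (Σℕ-pair n _ (suc x) (n ∸ suc x) x+1<n (ℕ.∸-monoʳ-< {o = 0} (s≤s z≤n) (ℕ.<⇒≤ x+1<n)) no-loop
                   (λ i _ → weight-0 i))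
          (cong₂ ℕ._+_ (weight-1 (adj-succ {n} {x} refl)) (weight-1 (adj-mirror {n} {x} (ℕ.<⇒≤ x+1<n) (no-loop ∘ sym) refl)))

module Folding (D r : ℕ) (r≤1 : r ≤ 1) where

  n : ℕ
  n = suc D ℕ.+ suc D ℕ.+ r

  mirror : ℕ → ℕ
  mirror x = n ∸ suc x

  -- The 0-based vertices x and n ∸ 2 ∸ x land on the same vertex of the path 0 — ⋯ — suc D.
  fold : ℕ → ℕ
  fold x = suc x ⊓ mirror x

  private
    E≤n : suc D ≤ n
    E≤n = ℕ.≤-trans (ℕ.m≤m+n (suc D) (suc D)) (ℕ.m≤m+n _ r)

    D+r≤E : D ℕ.+ r ≤ suc D
    D+r≤E = ℕ.≤-trans (ℕ.+-monoʳ-≤ D r≤1) (ℕ.≤-reflexive (ℕ.+-comm D 1))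

  mirror-left : ∀ {x} → x < suc D → suc D ≤ mirror x
  mirror-left x<E = ℕ.m+n≤o⇒m≤o∸n (suc D) (ℕ.≤-trans (ℕ.+-monoʳ-≤ (suc D) x<E) (ℕ.m≤m+n _ r))

  mirror-right : ∀ {x} → suc D ≤ x → mirror x ≤ D ℕ.+ r
  mirror-right {x} E≤x =
    ℕ.m≤n+o⇒m∸n≤o n (suc x) (s≤s (ℕ.≤-trans (ℕ.≤-reflexive (regroup D r)) (ℕ.+-monoˡ-≤ (D ℕ.+ r) E≤x)))
    where regroup : ∀ D r → D ℕ.+ suc D ℕ.+ r ≡ suc D ℕ.+ (D ℕ.+ r)
          regroup = ℕ.solve-∀

  mirror-D : mirror D ≡ suc D ℕ.+ r
  mirror-D = trans (cong (_∸ suc D) (ℕ.+-assoc (suc D) (suc D) r)) (ℕ.m+n∸m≡n (suc D) (suc D ℕ.+ r))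

  fold-left : ∀ {x} → x < suc D → fold x ≡ suc x
  fold-left x<E = ℕ.m≤n⇒m⊓n≡m (ℕ.m+n≤o⇒m≤o∸n _ (ℕ.≤-trans (ℕ.+-mono-≤ x<E x<E) (ℕ.m≤m+n _ r)))

  fold-right : ∀ {x} → suc D ≤ x → fold x ≡ mirror x
  fold-right E≤x = ℕ.m≥n⇒m⊓n≡n (ℕ.≤-trans (mirror-right E≤x) (ℕ.≤-trans D+r≤E (ℕ.≤-trans E≤x (ℕ.n≤1+n _))))

  fold-mirror-left : ∀ {x} → x < suc D → fold (mirror x) ≡ x
  fold-mirror-left x<E = trans (fold-right (mirror-left x<E)) (∸-suc-involutive (ℕ.≤-trans x<E E≤n))

  fold-top : fold (suc D) ≡ D ℕ.+ r
  fold-top = trans (fold-right ℕ.≤-refl) (trans (cong (_∸ suc (suc D)) (regroup D r)) (ℕ.m+n∸m≡n (suc (suc D)) (D ℕ.+ r)))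
    where regroup : ∀ D r → suc D ℕ.+ suc D ℕ.+ r ≡ suc (suc D) ℕ.+ (D ℕ.+ r)
          regroup = ℕ.solve-∀

  fold-≤ : ∀ x → fold x ≤ suc D
  fold-≤ x with x ℕ.<? suc D
  ... | yes x<E = ℕ.≤-trans (ℕ.≤-reflexive (fold-left x<E)) x<E
  ... | no  x≮E = ℕ.≤-trans (ℕ.≤-reflexive (fold-right (ℕ.≮⇒≥ x≮E))) (ℕ.≤-trans (mirror-right (ℕ.≮⇒≥ x≮E)) D+r≤E)

  E<n : suc D < n
  E<n = ℕ.≤-trans (ℕ.≤-reflexive (ℕ.+-comm 1 (suc D))) (ℕ.≤-trans (ℕ.+-monoʳ-≤ (suc D) (s≤s z≤n)) (ℕ.m≤m+n _ r))

  pathStep-top-unlooped : ∀ g → r ≡ 0 → pathStep (suc D) r g (suc D) ≡ g (fold (suc D))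
  pathStep-top-unlooped g r≡0 = begin
    pathStep (suc D) r g (suc D)  ≡⟨ pathStep-end D r g ⟩
    g D ℕ.+ r ℕ.* g (suc D)       ≡⟨ cong (λ r → g D ℕ.+ r ℕ.* g (suc D)) r≡0 ⟩
    g D ℕ.+ 0                     ≡⟨ ℕ.+-identityʳ (g D) ⟩
    g D                           ≡⟨ cong g (trans fold-top (trans (cong (D ℕ.+_) r≡0) (ℕ.+-identityʳ D))) ⟨
    g (fold (suc D))              ∎
    where open ≡-Reasoning

  pathStep-top-looped : ∀ g → r ≡ 1 → pathStep (suc D) r g (suc D) ≡ g D ℕ.+ g (fold (suc D))
  pathStep-top-looped g r≡1 = begin
    pathStep (suc D) r g (suc D)  ≡⟨ pathStep-end D r g ⟩
    g D ℕ.+ r ℕ.* g (suc D)       ≡⟨ cong (λ r → g D ℕ.+ r ℕ.* g (suc D)) r≡1 ⟩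
    g D ℕ.+ 1 ℕ.* g (suc D)       ≡⟨ cong (g D ℕ.+_) (ℕ.*-identityˡ (g (suc D))) ⟩
    g D ℕ.+ g (suc D)             ≡⟨ cong (λ m → g D ℕ.+ g m) (trans fold-top (trans (cong (D ℕ.+_) r≡1) (ℕ.+-comm D 1))) ⟨
    g D ℕ.+ g (fold (suc D))      ∎
    where open ≡-Reasoning

  adjSum-fold-last : ∀ {x} → suc x ≡ n → ∀ g → adjSum n x (g ∘ fold) ≡ pathStep (suc D) r g (fold x)
  adjSum-fold-last {x} x+1≡n g = begin
    adjSum n x (g ∘ fold)          ≡⟨ adjSum-last (g ∘ fold) x+1≡n ⟩
    g (fold 0)                     ≡⟨ cong g (fold-left (s≤s z≤n)) ⟩
    pathStep (suc D) r g 0         ≡⟨ cong (λ m → pathStep (suc D) r g (suc x ⊓ m)) (trans (cong (n ∸_) x+1≡n) (ℕ.n∸n≡0 n)) ⟨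
    pathStep (suc D) r g (fold x)  ∎
    where open ≡-Reasoning

  adjSum-fold-top : ∀ g → adjSum n D (g ∘ fold) ≡ pathStep (suc D) r g (fold D)
  adjSum-fold-top g = trans (by-loop (ℕ.n≤1⇒n≡0∨n≡1 r≤1)) (cong (pathStep (suc D) r g) (sym (fold-left ℕ.≤-refl)))
    where
    by-loop : r ≡ 0 ⊎ r ≡ 1 → adjSum n D (g ∘ fold) ≡ pathStep (suc D) r g (suc D)
    by-loop (inj₁ r≡0) = trans (adjSum-loop (g ∘ fold) E<n loop) (sym (pathStep-top-unlooped g r≡0))
      where loop : suc D ≡ mirror D
            loop = trans (sym (ℕ.+-identityʳ (suc D))) (trans (cong (suc D ℕ.+_) (sym r≡0)) (sym mirror-D))
    by-loop (inj₂ r≡1) = begin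
      adjSum n D (g ∘ fold)                     ≡⟨ adjSum-pair (g ∘ fold) E<n no-loop ⟩
      g (fold (suc D)) ℕ.+ g (fold (mirror D))  ≡⟨ cong (λ m → g (fold (suc D)) ℕ.+ g m) (fold-mirror-left ℕ.≤-refl) ⟩
      g (fold (suc D)) ℕ.+ g D                  ≡⟨ ℕ.+-comm (g (fold (suc D))) (g D) ⟩
      g D ℕ.+ g (fold (suc D))                  ≡⟨ pathStep-top-looped g r≡1 ⟨
      pathStep (suc D) r g (suc D)              ∎
      where
      open ≡-Reasoning
      no-loop : suc D ≢ mirror D
      no-loop e = ℕ.<-irrefl (trans e (trans mirror-D (trans (cong (suc D ℕ.+_) r≡1) (ℕ.+-comm (suc D) 1)))) (ℕ.n<1+n (suc D))

  adjSum-fold-left : ∀ {x} → x < suc D → suc x < n → ∀ g → adjSum n x (g ∘ fold) ≡ pathStep (suc D) r g (fold x)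
  adjSum-fold-left {x} x<E x+1<n g with suc x ℕ.<? suc D
  ... | yes x+1<E = begin
    adjSum n x (g ∘ fold)                     ≡⟨ adjSum-pair (g ∘ fold) x+1<n no-loop ⟩
    g (fold (suc x)) ℕ.+ g (fold (mirror x))  ≡⟨ cong₂ (λ a b → g a ℕ.+ g b) (fold-left x+1<E) (fold-mirror-left x<E) ⟩
    g (suc (suc x)) ℕ.+ g x                   ≡⟨ ℕ.+-comm (g (suc (suc x))) (g x) ⟩
    g x ℕ.+ g (suc (suc x))                   ≡⟨ pathStep-inner (suc D) r g x x+1<E ⟨
    pathStep (suc D) r g (suc x)              ≡⟨ cong (pathStep (suc D) r g) (fold-left x<E) ⟨
    pathStep (suc D) r g (fold x)             ∎
    where
    open ≡-Reasoning
    no-loop : suc x ≢ mirror x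
    no-loop e = ℕ.<⇒≱ x+1<E (ℕ.≤-trans (mirror-left x<E) (ℕ.≤-reflexive (sym e)))
  ... | no x+1≮E with ℕ.suc-injective (ℕ.≤-antisym x<E (ℕ.≮⇒≥ x+1≮E))
  ...   | refl = adjSum-fold-top g

  adjSum-fold-right : ∀ {x} → suc D ≤ x → suc x < n → ∀ g → adjSum n x (g ∘ fold) ≡ pathStep (suc D) r g (fold x)
  adjSum-fold-right {x} E≤x x+1<n g = begin
    adjSum n x (g ∘ fold)                     ≡⟨ adjSum-pair (g ∘ fold) x+1<n no-loop ⟩
    g (fold (suc x)) ℕ.+ g (fold (mirror x))  ≡⟨ cong₂ (λ a b → g a ℕ.+ g (fold b)) (fold-right (ℕ.m≤n⇒m≤1+n E≤x)) mirror≡ ⟩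
    g c ℕ.+ g (fold (suc c))                  ≡⟨ step-at (suc c ℕ.<? suc D) ⟩
    pathStep (suc D) r g (suc c)              ≡⟨ cong (pathStep (suc D) r g) (trans (fold-right E≤x) mirror≡) ⟨
    pathStep (suc D) r g (fold x)             ∎
    where
    open ≡-Reasoning
    c : ℕ
    c = mirror (suc x)
    mirror≡ : mirror x ≡ suc c
    mirror≡ = ∸-suc-step x+1<n
    mirror≤D+r : suc c ≤ D ℕ.+ r
    mirror≤D+r = ℕ.≤-trans (ℕ.≤-reflexive (sym mirror≡)) (mirror-right E≤x)
    no-loop : suc x ≢ mirror x
    no-loop e = ℕ.<-irrefl refl (ℕ.≤-trans (ℕ.≤-reflexive e) (ℕ.≤-trans (mirror-right E≤x) (ℕ.≤-trans D+r≤E E≤x)))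
    step-at : Dec (suc c < suc D) → g c ℕ.+ g (fold (suc c)) ≡ pathStep (suc D) r g (suc c)
    step-at (yes c+1<E) = trans (cong (λ m → g c ℕ.+ g m) (fold-left c+1<E)) (sym (pathStep-inner (suc D) r g c c+1<E))
    step-at (no  c+1≮E) = begin
      g c ℕ.+ g (fold (suc c))    ≡⟨ cong (λ m → g m ℕ.+ g (fold (suc m))) c≡D ⟩
      g D ℕ.+ g (fold (suc D))    ≡⟨ pathStep-top-looped g r≡1 ⟨
      pathStep (suc D) r g (suc D) ≡⟨ cong (λ m → pathStep (suc D) r g (suc m)) c≡D ⟨
      pathStep (suc D) r g (suc c) ∎
      where
      c≡D : c ≡ D
      c≡D = ℕ.suc-injective (ℕ.≤-antisym (ℕ.≤-trans mirror≤D+r D+r≤E) (ℕ.≮⇒≥ c+1≮E))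
      r≡1 : r ≡ 1
      r≡1 with ℕ.n≤1⇒n≡0∨n≡1 r≤1
      ... | inj₂ r≡1 = r≡1
      ... | inj₁ r≡0 = ⊥-elim (ℕ.<-irrefl refl (ℕ.≤-trans (ℕ.≤-reflexive (cong suc (sym c≡D)))
                          (ℕ.≤-trans mirror≤D+r (ℕ.≤-reflexive (trans (cong (D ℕ.+_) r≡0) (ℕ.+-identityʳ D))))))

  adjSum-fold : ∀ x → x < n → ∀ g → adjSum n x (g ∘ fold) ≡ pathStep (suc D) r g (fold x)
  adjSum-fold x x<n with suc x ℕ.≟ n | x ℕ.<? suc D
  ... | yes x+1≡n | _       = adjSum-fold-last x+1≡n
  ... | no  x+1≢n | yes x<E = adjSum-fold-left x<E (ℕ.≤∧≢⇒< x<n x+1≢n)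
  ... | no  x+1≢n | no  x≮E = adjSum-fold-right (ℕ.≮⇒≥ x≮E) (ℕ.≤∧≢⇒< x<n x+1≢n)

  walks-fold : ∀ t (i : Fin n) → w n (suc t) i ≡ pathWalks (suc D) r (suc t) (fold (toℕ i))
  walks-fold zero    i = refl
  walks-fold (suc t) i = begin
    ΣFin (λ j → a n i j ℕ.* w n (suc t) j)
      ≡⟨ ΣFin-cong (λ j → cong (a n i j ℕ.*_) (walks-fold t j)) ⟩
    ΣFin (λ j → a n i j ℕ.* pathWalks (suc D) r (suc t) (fold (toℕ j)))
      ≡⟨ ΣFin≡Σℕ n (λ y → adj n (toℕ i) y ℕ.* pathWalks (suc D) r (suc t) (fold y)) ⟩
    adjSum n (toℕ i) (pathWalks (suc D) r (suc t) ∘ fold)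
      ≡⟨ adjSum-fold (toℕ i) (FinP.toℕ<n i) (pathWalks (suc D) r (suc t)) ⟩
    pathWalks (suc D) r (suc (suc t)) (fold (toℕ i))
      ∎
    where open ≡-Reasoning

α-annihilates-f-halved : ∀ D r → r ≤ 1 →
  let n = suc D ℕ.+ suc D ℕ.+ r in Annihilates (α n) n (λ t → + f n t)
α-annihilates-f-halved D r r≤1 = annihilates-ΣFin n (w n) per-vertex
  where
  open Folding D r r≤1
  open Walks (suc D) r
  ann₀ : Annihilates (α n) n (walks 0)
  ann₀ = annihilates-coeff-cong (λ j j≤n → sym (α≡loopedPathPoly (suc D) r j r≤1 j≤n))
           (annihilates-raise E<n (loopedPathPoly-vanishes (suc D) r) (walks₀-annihilated D r))
  per-vertex : ∀ i → Annihilates (α n) n (λ t → + w n t i)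
  per-vertex i = annihilates-cong (λ { (suc t) _ → sym (cong +_ (walks-fold t i)) })
                   (walks-annihilated ann₀ (fold (toℕ i)) (fold-≤ (toℕ i)))

halve : ∀ m → ∃ λ D → ∃ λ r → r ≤ 1 × suc (suc m) ≡ suc D ℕ.+ suc D ℕ.+ r
halve zero          = 0 , 0 , z≤n , refl
halve (suc zero)    = 0 , 1 , s≤s z≤n , refl
halve (suc (suc m)) with halve m
... | D , r , r≤1 , m+2≡ = suc D , r , r≤1 , trans (cong (suc ∘ suc) m+2≡) (regroup D r)
  where regroup : ∀ D r → suc (suc (suc D ℕ.+ suc D ℕ.+ r)) ≡ suc (suc D) ℕ.+ suc (suc D) ℕ.+ r
        regroup = ℕ.solve-∀

α-annihilates-f : ∀ n → 2 ≤ n → Annihilates (α n) n (λ t → + f n t)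
α-annihilates-f (suc (suc m)) (s≤s (s≤s z≤n)) with halve m
... | D , r , r≤1 , m+2≡ = subst (λ n → Annihilates (α n) n (λ t → + f n t)) (sym m+2≡) (α-annihilates-f-halved D r r≤1)

theorem2p3 : (n : ℕ) → 2 ≤ n → (k : ℕ) → n < k →
    ΣFinℤ (λ (j : Fin (suc n)) → α n (toℕ j) * + f n (k ∸ toℕ j)) ≡ + 0
theorem2p3 n 2≤n k n<k =
  trans (ΣFinℤ≡Σℤ (suc n) (λ j → α n j * + f n (k ∸ j))) (Annihilates.convolve≡0 (α-annihilates-f n 2≤n) k n<k)
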